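{- Let $G$ be a chordless graph. Then either $G$ is sparse, or $G$ admits a 1-cutset, or $G$ admits a proper 2-cutset.
   Context: A graph is chordless if none of its cycles (as subgraphs) has a chord. A graph is sparse if no two vertices of degree at least 3 are adjacent. A $k$-cutset is a set $S\subseteq V(G)$ of size $k$ such that $G\setminus S$ is disconnected. A 2-cutset $\{a,b\}$ is proper if $a\neq b$, $ab\notin E(G)$, $V(G)\setminus\{a,b\}$ can be partitioned into non-empty sets $X,Y$ with no edge between $X$ and $Y$, and neither $G[X\cup\{a,b\}]$ nor $G[Y\cup\{a,b\}]$ is a path from $a$ to $b$. -}

module Defs where

open import Data.Nat using (ℕ; zero; suc; _+_; _≤_; _<_)
open import Data.Fin using (Fin; toℕ)
open import Data.Bool using (Bool; true; false)
open import Data.List using (length; filterᵇ; allFin)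
open import Data.Product using (Σ; ∃; _×_; _,_)
open import Data.Sum using (_⊎_)
open import Relation.Nullary using (¬_)
open import Relation.Binary.PropositionalEquality using (_≡_)
open import Function.Definitions using (Injective)
open import Function.Bundles using (_⇔_)

record Graph : Set where
  field
    n      : ℕ
    adj    : Fin n → Fin n → Bool
    sym    : ∀ u v → adj u v ≡ adj v u
    irrefl : ∀ v → adj v v ≡ false

module _ (G : Graph) where
  open Graph G

  V : Set
  V = Fin n

  E : V → V → Set
  E u v = adj u v ≡ true

  deg : V → ℕ
  deg v = length (filterᵇ (adj v) (allFin n))

  Sparse : Set
  Sparse = ∀ u v → E u v → ¬ (3 ≤ deg u × 3 ≤ deg v)

  CycConsec : (k : ℕ) → Fin k → Fin k → Set
  CycConsec k i j = suc (toℕ i) ≡ toℕ j ⊎ suc (toℕ j) ≡ toℕ i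
                  ⊎ (toℕ i ≡ 0 × suc (toℕ j) ≡ k) ⊎ (toℕ j ≡ 0 × suc (toℕ i) ≡ k)

  IsCycle : (k : ℕ) → (Fin k → V) → Set
  IsCycle k c = 3 ≤ k × Injective _≡_ _≡_ c
              × (∀ i j → CycConsec k i j → E (c i) (c j))

  HasChord : (k : ℕ) → (Fin k → V) → Set
  HasChord k c = Σ (Fin k) λ i → Σ (Fin k) λ j → E (c i) (c j) × ¬ CycConsec k i j

  Chordless : Set
  Chordless = ∀ k (c : Fin k → V) → IsCycle k c → ¬ HasChord k c

  module _ (S : V → Set) (side : V → Bool) where
    InX : V → Set
    InX v = ¬ S v × side v ≡ true
    InY : V → Set
    InY v = ¬ S v × side v ≡ false

    Separation : Set
    Separation = (∃ λ x → InX x) × (∃ λ y → InY y)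
               × (∀ x y → InX x → InY y → ¬ E x y)

  DisconnectedWithout : (V → Set) → Set
  DisconnectedWithout S = ∃ λ side → Separation S side

  Has1Cutset : Set
  Has1Cutset = ∃ λ (a : V) → DisconnectedWithout (λ v → v ≡ a)

  InducedPathFromTo : (V → Set) → V → V → Set
  InducedPathFromTo T a b =
    Σ ℕ λ m → Σ (Fin m → V) λ p →
      Injective _≡_ _≡_ p
      × (∀ v → T v ⇔ (∃ λ i → p i ≡ v))
      × (∃ λ i → toℕ i ≡ 0 × p i ≡ a)
      × (∃ λ j → suc (toℕ j) ≡ m × p j ≡ b)
      × (∀ i j → E (p i) (p j) ⇔ (suc (toℕ i) ≡ toℕ j ⊎ suc (toℕ j) ≡ toℕ i))

  HasProper2Cutset : Set
  HasProper2Cutset =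
    Σ V λ a → Σ V λ b → Σ (V → Bool) λ side →
      ¬ a ≡ b × ¬ E a b
      × Separation (λ v → v ≡ a ⊎ v ≡ b) side
      × ¬ InducedPathFromTo (λ v → InX (λ v → v ≡ a ⊎ v ≡ b) side v ⊎ v ≡ a ⊎ v ≡ b) a b
      × ¬ InducedPathFromTo (λ v → InY (λ v → v ≡ a ⊎ v ≡ b) side v ⊎ v ≡ a ⊎ v ≡ b) a b

module Submission where

-- Let uv be an edge whose ends both have degree at least 3. If no vertex w separates u from v in
-- G − uv, a fan argument (Menger for two paths) yields two internally disjoint u–v paths in G − uv;
-- each has at least two edges, so together they form a cycle with chord uv. Hence some w separates
-- u from v in G − uv. If w is not adjacent to u then {u, w} is a 2-cutset, and it is proper: on u's
-- side u keeps two neighbours other than v, so that side is no path ending at u, and on the other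
-- side v has three neighbours, more than any vertex of a path. The case wv ∉ E is symmetric. If uvw
-- is a triangle, pick a neighbour u′ ∉ {v, w} of u: either u separates u′ from w, or a u′–w walk
-- avoiding u meets w before v (it cannot meet v first, as w separates u from v), giving a u–w path
-- in G − uw − v; then v no longer separates u from w in G − uw, nor does any other vertex (u v w is
-- a path), and the fan argument for the edge uw again yields a chorded cycle.

open import Level using (0ℓ)
open import Data.Bool as Bool using (true)
open import Data.Bool.Properties using (T-≡)
open import Data.Empty using (⊥; ⊥-elim)
open import Data.Fin as Fin using (Fin; toℕ; fromℕ<)
open import Data.Fin.Properties
  using (toℕ-injective; toℕ-fromℕ<; toℕ<n; toℕ≤pred[n]; injective⇒≤; any?)
open import Data.List using (List; []; _∷_; [_]; length; filterᵇ; allFin)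
open import Data.List.Membership.Propositional using (_∈_; _∉_; lose)
open import Data.List.Membership.Propositional.Properties using (∈-filter⁻)
open import Data.List.Relation.Binary.Subset.Propositional using (_⊆_)
open import Data.List.Relation.Unary.All using ([]; _∷_)
open import Data.List.Relation.Unary.All.Properties using (All¬⇒¬Any; ¬Any⇒All¬)
open import Data.List.Relation.Unary.Any using (Any; here; there)
open import Data.List.Relation.Unary.Unique.Propositional using (Unique; []; _∷_)
open import Data.List.Relation.Unary.Unique.Propositional.Properties using (filter⁺; allFin⁺)
open import Data.Nat using (ℕ; zero; suc; pred; _+_; _≤_; _<_; _≤?_; z≤n; s≤s)
open import Data.Nat.Properties using (≤-trans; ≤-refl; n≤1+n; <⇒≤; <-irrefl; +-monoʳ-≤; +-comm; m≤n+m)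
open import Data.Product as Product using (Σ; ∃; ∃₂; _×_; _,_; proj₁; proj₂)
open import Data.Sum as Sum using (_⊎_; inj₁; inj₂)
open import Function using (_∘_)
open import Function.Bundles using (Equivalence)
open import Relation.Binary using (Rel; Decidable; DecidableEquality; Symmetric; _⇒_)
open import Relation.Binary.Construct.Closure.ReflexiveTransitive
  as Star using (Star; ε; _◅_; _◅◅_; revApp; reverse)
open import Relation.Binary.PropositionalEquality
  using (_≡_; _≢_; refl; sym; trans; cong; subst; subst₂)
open import Relation.Nullary using (¬_; Dec; yes; no; ¬?; _×-dec_; _⊎-dec_)
open import Relation.Nullary.Decidable using (T?; does; dec-true; dec-false; decidable-stable)
open import Relation.Unary using (Pred) renaming (Decidable to Decidable₁)

open import Defs

-- Walks and paths

module _ {A : Set} where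

  private
    variable
      R S : Rel A 0ℓ
      x y z t : A
      xs : List A

  ∉⇒Unique-∷ : x ∉ xs → Unique xs → Unique (x ∷ xs)
  ∉⇒Unique-∷ {xs = xs} x∉ u = ¬Any⇒All¬ xs x∉ ∷ u

  vertices : Star R x y → List A
  vertices {x = x} ε = [ x ]
  vertices {x = x} (_ ◅ w) = x ∷ vertices w

  len : Star R x y → ℕ
  len ε = 0
  len (_ ◅ w) = suc (len w)

  IsPath : Star R x y → Set
  IsPath w = Unique (vertices w)

  start∈ : (w : Star R x y) → x ∈ vertices w
  start∈ ε = here refl
  start∈ (_ ◅ w) = here refl

  end∈ : (w : Star R x y) → y ∈ vertices w
  end∈ ε = here refl
  end∈ (_ ◅ w) = there (end∈ w)

  edge-isPath : (e : R x y) → x ≢ y → IsPath {R = R} (e ◅ ε)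
  edge-isPath _ x≢y = ∉⇒Unique-∷ (λ { (here x≡y) → x≢y x≡y }) ([] ∷ [])

  ∈-◅◅⁻ : (v : Star R x y) (w : Star R y z)
        → t ∈ vertices (v ◅◅ w) → t ∈ vertices v ⊎ t ∈ vertices w
  ∈-◅◅⁻ ε w m = inj₂ m
  ∈-◅◅⁻ (_ ◅ v) w (here eq) = inj₁ (here eq)
  ∈-◅◅⁻ (_ ◅ v) w (there m) = Sum.map₁ there (∈-◅◅⁻ v w m)

  ∈-◅◅⁺ˡ : (v : Star R x y) (w : Star R y z) → vertices v ⊆ vertices (v ◅◅ w)
  ∈-◅◅⁺ˡ ε w (here refl) = start∈ w
  ∈-◅◅⁺ˡ (_ ◅ v) w (here eq) = here eq
  ∈-◅◅⁺ˡ (_ ◅ v) w (there m) = there (∈-◅◅⁺ˡ v w m)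

  ∈-◅◅⁺ʳ : (v : Star R x y) (w : Star R y z) → vertices w ⊆ vertices (v ◅◅ w)
  ∈-◅◅⁺ʳ ε w m = m
  ∈-◅◅⁺ʳ (_ ◅ v) w m = there (∈-◅◅⁺ʳ v w m)

  ◅◅-isPath : (v : Star R x y) (w : Star R y z) → IsPath v → IsPath w
            → (∀ {t} → t ∈ vertices v → t ∈ vertices w → t ≡ y) → IsPath (v ◅◅ w)
  ◅◅-isPath ε w _ pw _ = pw
  ◅◅-isPath (_ ◅ v) w (x∉ ∷ pv) pw meet =
    ∉⇒Unique-∷ x∉vw (◅◅-isPath v w pv pw (meet ∘ there))
    where
      x∉vw : _ ∉ vertices (v ◅◅ w)
      x∉vw m with ∈-◅◅⁻ v w m
      ... | inj₁ m′ = All¬⇒¬Any x∉ m′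
      ... | inj₂ m′ = All¬⇒¬Any x∉ (subst (_∈ vertices v) (sym (meet (here refl) m′)) (end∈ v))

  ◅◅-isPath⁻ˡ : (v : Star R x y) (w : Star R y z) → IsPath (v ◅◅ w) → IsPath v
  ◅◅-isPath⁻ˡ ε w _ = [] ∷ []
  ◅◅-isPath⁻ˡ (_ ◅ v) w (x∉ ∷ p) =
    ∉⇒Unique-∷ (All¬⇒¬Any x∉ ∘ ∈-◅◅⁺ˡ v w) (◅◅-isPath⁻ˡ v w p)

  ◅◅-isPath⁻ʳ : (v : Star R x y) (w : Star R y z) → IsPath (v ◅◅ w) → IsPath w
  ◅◅-isPath⁻ʳ ε w p = p
  ◅◅-isPath⁻ʳ (_ ◅ v) w (_ ∷ p) = ◅◅-isPath⁻ʳ v w p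

  ◅◅-isPath-meet : (v : Star R x y) (w : Star R y z) → IsPath (v ◅◅ w)
                 → t ∈ vertices v → t ∈ vertices w → t ≡ y
  ◅◅-isPath-meet ε w _ (here refl) _ = refl
  ◅◅-isPath-meet (_ ◅ v) w (x∉ ∷ _) (here refl) m = ⊥-elim (All¬⇒¬Any x∉ (∈-◅◅⁺ʳ v w m))
  ◅◅-isPath-meet (_ ◅ v) w (_ ∷ p) (there m′) m = ◅◅-isPath-meet v w p m′ m

  module _ (R-sym : Symmetric R) where

    ∈-revApp⁻ : (w : Star R y x) (acc : Star R y z)
              → t ∈ vertices (revApp R-sym w acc) → t ∈ vertices w ⊎ t ∈ vertices acc
    ∈-revApp⁻ ε acc m = inj₂ m
    ∈-revApp⁻ (e ◅ w) acc m with ∈-revApp⁻ w (R-sym e ◅ acc) m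
    ... | inj₁ m′ = inj₁ (there m′)
    ... | inj₂ (here refl) = inj₁ (there (start∈ w))
    ... | inj₂ (there m′) = inj₂ m′

    revApp-isPath : (w : Star R y x) (acc : Star R y z) → IsPath w → IsPath acc
                  → (∀ {t} → t ∈ vertices w → t ∈ vertices acc → t ≡ y)
                  → IsPath (revApp R-sym w acc)
    revApp-isPath ε acc _ pacc _ = pacc
    revApp-isPath (e ◅ w) acc (y∉ ∷ pw) pacc meet =
      revApp-isPath w (R-sym e ◅ acc) pw (∉⇒Unique-∷ y′∉acc pacc) meet′
      where
        y′∉acc : _ ∉ vertices acc
        y′∉acc m = All¬⇒¬Any y∉ (subst (_∈ vertices w) (meet (there (start∈ w)) m) (start∈ w))
        meet′ : ∀ {t} → t ∈ vertices w → t ∈ vertices (R-sym e ◅ acc) → t ≡ _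
        meet′ _ (here eq) = eq
        meet′ m (there m′) = ⊥-elim (All¬⇒¬Any y∉ (subst (_∈ vertices w) (meet (there m) m′) m))

    ∈-reverse⁻ : (w : Star R x y) → vertices (reverse R-sym w) ⊆ vertices w
    ∈-reverse⁻ w m with ∈-revApp⁻ w ε m
    ... | inj₁ m′ = m′
    ... | inj₂ (here refl) = start∈ w

    reverse-isPath : (w : Star R x y) → IsPath w → IsPath (reverse R-sym w)
    reverse-isPath w pw = revApp-isPath w ε pw ([] ∷ []) λ { _ (here eq) → eq }

  vertices-map : (f : R ⇒ S) (w : Star R x y) → vertices (Star.map f w) ≡ vertices w
  vertices-map f ε = refl
  vertices-map f (_ ◅ w) = cong (_ ∷_) (vertices-map f w)

  ∈-map⁻ : (f : R ⇒ S) (w : Star R x y) → vertices (Star.map f w) ⊆ vertices w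
  ∈-map⁻ f w = subst (_ ∈_) (vertices-map f w)

  map-isPath : (f : R ⇒ S) (w : Star R x y) → IsPath w → IsPath (Star.map f w)
  map-isPath f w = subst Unique (sym (vertices-map f w))

  splitAt : (w : Star R x y) → z ∈ vertices w → ∃₂ λ (v : Star R x z) (u : Star R z y) → v ◅◅ u ≡ w
  splitAt ε (here refl) = ε , ε , refl
  splitAt (e ◅ w) (here refl) = ε , e ◅ w , refl
  splitAt (e ◅ w) (there m) with splitAt w m
  ... | v , u , refl = e ◅ v , u , refl

  record FirstHit (D : Pred A 0ℓ) (w : Star R x y) : Set where
    field
      {hit} : A
      before : Star R x hit
      hits : D hit
      first : ∀ {t} → t ∈ vertices before → D t → t ≡ hit
      before⊆ : vertices before ⊆ vertices w
      before-isPath : IsPath w → IsPath before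

  firstHit : {D : Pred A 0ℓ} → Decidable₁ D → (w : Star R x y) → Any D (vertices w) → FirstHit D w
  firstHit {x = x} D? w any with D? x
  ... | yes dx = record
    { before = ε ; hits = dx ; first = λ { (here refl) _ → refl }
    ; before⊆ = λ { (here refl) → start∈ w } ; before-isPath = λ _ → [] ∷ [] }
  firstHit D? ε (here dx) | no ¬dx = ⊥-elim (¬dx dx)
  firstHit D? (_ ◅ w) (here dx) | no ¬dx = ⊥-elim (¬dx dx)
  firstHit D? (e ◅ w) (there any) | no ¬dx = record
    { before = e ◅ before ; hits = hits
    ; first = λ { (here refl) dx → ⊥-elim (¬dx dx) ; (there m) → first m }
    ; before⊆ = λ { (here eq) → here eq ; (there m) → there (before⊆ m) }
    ; before-isPath = λ { (x∉ ∷ pw) →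
        ∉⇒Unique-∷ (All¬⇒¬Any x∉ ∘ before⊆) (before-isPath pw) } }
    where open FirstHit (firstHit D? w any)

  prefix : (w : Star R x y) → IsPath w → z ∈ vertices w
         → Σ (Star R x z) λ v → IsPath v × vertices v ⊆ vertices w × (y ∈ vertices v → y ≡ z)
  prefix w pw z∈ with splitAt w z∈
  ... | v , u , refl =
    v , ◅◅-isPath⁻ˡ v u pw , ∈-◅◅⁺ˡ v u , λ y∈v → ◅◅-isPath-meet v u pw y∈v (end∈ u)

  module _ (_≟_ : DecidableEquality A) where
    open import Data.List.Membership.DecPropositional _≟_ using (_∈?_)

    toPath : (w : Star R x y) → Σ (Star R x y) λ w′ → IsPath w′ × vertices w′ ⊆ vertices w
    toPath ε = ε , [] ∷ [] , λ m → m
    toPath {x = x} (e ◅ w) with toPath w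
    ... | w′ , pw′ , w′⊆w with x ∈? vertices w′
    ...   | no x∉ =
      e ◅ w′ , ∉⇒Unique-∷ x∉ pw′ , λ { (here eq) → here eq ; (there m) → there (w′⊆w m) }
    ...   | yes x∈ with splitAt w′ x∈
    ...     | v , u , refl = u , ◅◅-isPath⁻ʳ v u pw′ , there ∘ w′⊆w ∘ ∈-◅◅⁺ʳ v u

  len-◅◅ : (v : Star R x y) (w : Star R y z) → len (v ◅◅ w) ≡ len v + len w
  len-◅◅ ε w = refl
  len-◅◅ (_ ◅ v) w = cong suc (len-◅◅ v w)

  2≤len : (w : Star R x y) → x ≢ y → ¬ R x y → 2 ≤ len w
  2≤len ε x≢y _ = ⊥-elim (x≢y refl)
  2≤len (e ◅ ε) _ ¬e = ⊥-elim (¬e e)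
  2≤len (_ ◅ _ ◅ _) _ _ = s≤s (s≤s z≤n)

  -- The i-th vertex of w; junk (the end vertex) for i > len w.
  at : Star R x y → ℕ → A
  at {x = x} _ zero = x
  at {x = x} ε (suc _) = x
  at (_ ◅ w) (suc i) = at w i

  at-len : (w : Star R x y) → at w (len w) ≡ y
  at-len ε = refl
  at-len (_ ◅ w) = at-len w

  at-step : (w : Star R x y) {i : ℕ} → suc i ≤ len w → R (at w i) (at w (suc i))
  at-step (e ◅ w) {zero} _ = e
  at-step (_ ◅ w) {suc i} (s≤s i<len) = at-step w i<len

  at∈vertices : (w : Star R x y) {i : ℕ} → i ≤ len w → at w i ∈ vertices w
  at∈vertices w {zero} _ = start∈ w
  at∈vertices (_ ◅ w) {suc i} (s≤s i≤len) = there (at∈vertices w i≤len)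

  at-injective : (w : Star R x y) → IsPath w
               → {i j : ℕ} → i ≤ len w → j ≤ len w → at w i ≡ at w j → i ≡ j
  at-injective w _ {zero} {zero} _ _ _ = refl
  at-injective (_ ◅ w) (x∉ ∷ _) {zero} {suc j} _ (s≤s j≤) eq =
    ⊥-elim (All¬⇒¬Any x∉ (subst (_∈ vertices w) (sym eq) (at∈vertices w j≤)))
  at-injective (_ ◅ w) (x∉ ∷ _) {suc i} {zero} (s≤s i≤) _ eq =
    ⊥-elim (All¬⇒¬Any x∉ (subst (_∈ vertices w) eq (at∈vertices w i≤)))
  at-injective (_ ◅ w) (_ ∷ pw) {suc i} {suc j} (s≤s i≤) (s≤s j≤) eq =
    cong suc (at-injective w pw i≤ j≤ eq)

  at-◅◅ˡ : (v : Star R x y) (w : Star R y z) {i : ℕ} → i ≤ len v → at (v ◅◅ w) i ≡ at v i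
  at-◅◅ˡ v w {zero} _ = refl
  at-◅◅ˡ (_ ◅ v) w {suc i} (s≤s i≤) = at-◅◅ˡ v w i≤

  edge◅path-at-injective : (e : R x y) (P : Star R y x) → IsPath P → {i j : ℕ}
                         → i < suc (len P) → j < suc (len P) → at (e ◅ P) i ≡ at (e ◅ P) j → i ≡ j
  edge◅path-at-injective e P pP {zero} {zero} _ _ _ = refl
  edge◅path-at-injective e P pP {zero} {suc j} _ (s≤s j<len) x≡Pj =
    ⊥-elim (<-irrefl (at-injective P pP (<⇒≤ j<len) ≤-refl (trans (sym x≡Pj) (sym (at-len P)))) j<len)
  edge◅path-at-injective e P pP {suc i} {zero} (s≤s i<len) _ Pi≡x =
    ⊥-elim (<-irrefl (at-injective P pP (<⇒≤ i<len) ≤-refl (trans Pi≡x (sym (at-len P)))) i<len)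
  edge◅path-at-injective e P pP {suc i} {suc j} (s≤s i<len) (s≤s j<len) eq =
    cong suc (at-injective P pP (<⇒≤ i<len) (<⇒≤ j<len) eq)

  infixl 6 _-ᵛ_ _-ᵉ_

  _-ᵛ_ : Rel A 0ℓ → A → Rel A 0ℓ
  (R -ᵛ u) x y = R x y × x ≢ u × y ≢ u

  _-ᵉ_ : Rel A 0ℓ → A × A → Rel A 0ℓ
  (R -ᵉ (p , q)) x y = R x y × ¬ (x ≡ p × y ≡ q) × ¬ (x ≡ q × y ≡ p)

  -ᵛ-sym : {u : A} → Symmetric R → Symmetric (R -ᵛ u)
  -ᵛ-sym R-sym (r , x≢u , y≢u) = R-sym r , y≢u , x≢u

  -ᵉ-sym : {p q : A} → Symmetric R → Symmetric (R -ᵉ (p , q))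
  -ᵉ-sym R-sym (r , ¬pq , ¬qp) =
    R-sym r , (λ (y≡p , x≡q) → ¬qp (x≡q , y≡p)) , (λ (y≡q , x≡p) → ¬pq (x≡p , y≡q))

  -ᵉ-swap : {p q : A} → (R -ᵉ (p , q)) ⇒ (R -ᵉ (q , p))
  -ᵉ-swap (r , ¬pq , ¬qp) = r , ¬qp , ¬pq

  -ᵛ⇒-ᵉ : {p q : A} → (R -ᵛ p) ⇒ (R -ᵉ (p , q))
  -ᵛ⇒-ᵉ (r , x≢p , y≢p) = r , x≢p ∘ proj₁ , y≢p ∘ proj₂

  restrict : {u : A} (w : Star R x y) → (∀ {t} → t ∈ vertices w → t ≢ u) → Star (R -ᵛ u) x y
  restrict ε _ = ε
  restrict (r ◅ w) avoids = (r , avoids (here refl) , avoids (there (start∈ w))) ◅ restrict w (avoids ∘ there)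

  -ᵛ-avoids : {u : A} (w : Star (R -ᵛ u) x y) → x ≢ u → ∀ {t} → t ∈ vertices w → t ≢ u
  -ᵛ-avoids ε x≢u (here refl) = x≢u
  -ᵛ-avoids (_ ◅ w) x≢u (here refl) = x≢u
  -ᵛ-avoids ((_ , _ , y≢u) ◅ w) _ (there m) = -ᵛ-avoids w y≢u m

  -ᵛ-source : {u : A} → Star (R -ᵛ u) x y → x ≢ y → x ≢ u
  -ᵛ-source ε x≢y = ⊥-elim (x≢y refl)
  -ᵛ-source ((_ , x≢u , _) ◅ _) _ = x≢u

  module _ (_≟_ : DecidableEquality A) (R? : Decidable R) where

    -ᵛ-dec : (u : A) → Decidable (R -ᵛ u)
    -ᵛ-dec u x y = R? x y ×-dec ¬? (x ≟ u) ×-dec ¬? (y ≟ u)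

    -ᵉ-dec : (p q : A) → Decidable (R -ᵉ (p , q))
    -ᵉ-dec p q x y = R? x y ×-dec ¬? ((x ≟ p) ×-dec (y ≟ q)) ×-dec ¬? ((x ≟ q) ×-dec (y ≟ p))

  -- Two internally disjoint paths

  record DisjointPaths (R : Rel A 0ℓ) (p x : A) : Set where
    field
      left right : Star R p x
      left-isPath : IsPath left
      right-isPath : IsPath right
      meet : ∀ {t} → t ∈ vertices left → t ∈ vertices right → t ≡ p ⊎ t ≡ x

    swap : DisjointPaths R p x
    swap = record { left = right ; right = left ; left-isPath = right-isPath ; right-isPath = left-isPath
                  ; meet = λ l r → meet r l }

  module Fan (_≟_ : DecidableEquality A) {H : Rel A 0ℓ} (H-sym : Symmetric H) {p q : A}
             (unseparated : ∀ u → u ≢ p → u ≢ q → Star (H -ᵛ u) p q) where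

    open import Data.List.Membership.DecPropositional _≟_ using (_∈?_)
    open DisjointPaths

    reroute : (D : DisjointPaths H p x) → H x y → y ≢ p
            → (Rh : Star H y z) → IsPath Rh → (∀ {t} → t ∈ vertices Rh → t ≢ x)
            → (∀ {t} → t ∈ vertices Rh → t ∈ vertices (left D) ⊎ t ∈ vertices (right D) → t ≡ z)
            → z ∈ vertices (left D) → DisjointPaths H p y
    reroute {x = x} {y = y} {z = z} D xy y≢p Rh pRh Rh∌x firstOnRh z∈left
      with prefix (left D) (left-isPath D) z∈left
    ... | A₁ , pA₁ , A₁⊆left , x∈A₁⇒x≡z = record
      { left = A₁ ◅◅ reverse H-sym Rh
      ; right = right D ◅◅ xyWalk
      ; left-isPath = ◅◅-isPath A₁ (reverse H-sym Rh) pA₁ (reverse-isPath H-sym Rh pRh)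
                        λ m₁ m₂ → firstOnRh (∈-reverse⁻ H-sym Rh m₂) (inj₁ (A₁⊆left m₁))
      ; right-isPath = ◅◅-isPath (right D) xyWalk (right-isPath D)
                         (edge-isPath {R = H} xy (Rh∌x (start∈ Rh) ∘ sym)) meetʳ
      ; meet = meet′ }
      where
        xyWalk : Star H x y
        xyWalk = xy ◅ ε

        z≢x : z ≢ x
        z≢x = Rh∌x (end∈ Rh)

        x∉A₁ : x ∉ vertices A₁
        x∉A₁ = z≢x ∘ sym ∘ x∈A₁⇒x≡z

        z∈right⇒z≡p : z ∈ vertices (right D) → z ≡ p
        z∈right⇒z≡p z∈right with meet D z∈left z∈right
        ... | inj₁ z≡p = z≡p
        ... | inj₂ z≡x = ⊥-elim (z≢x z≡x)

        Rh∩right⇒p : ∀ {t} → t ∈ vertices Rh → t ∈ vertices (right D) → t ≡ p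
        Rh∩right⇒p t∈Rh t∈right with firstOnRh t∈Rh (inj₂ t∈right)
        ... | refl = z∈right⇒z≡p t∈right

        meetʳ : ∀ {t} → t ∈ vertices (right D) → t ∈ vertices xyWalk → t ≡ x
        meetʳ _ (here t≡x) = t≡x
        meetʳ t∈right (there (here refl)) = ⊥-elim (y≢p (Rh∩right⇒p (start∈ Rh) t∈right))

        meet′ : ∀ {t} → t ∈ vertices (A₁ ◅◅ reverse H-sym Rh) → t ∈ vertices (right D ◅◅ xyWalk)
              → t ≡ p ⊎ t ≡ y
        meet′ m₁ m₂ with ∈-◅◅⁻ (right D) xyWalk m₂ | ∈-◅◅⁻ A₁ (reverse H-sym Rh) m₁
        ... | inj₂ (there (here t≡y)) | _ = inj₂ t≡y
        ... | inj₂ (here refl) | inj₁ t∈A₁ = ⊥-elim (x∉A₁ t∈A₁)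
        ... | inj₂ (here refl) | inj₂ t∈Rh = ⊥-elim (Rh∌x (∈-reverse⁻ H-sym Rh t∈Rh) refl)
        ... | inj₁ t∈right | inj₂ t∈Rh = inj₁ (Rh∩right⇒p (∈-reverse⁻ H-sym Rh t∈Rh) t∈right)
        ... | inj₁ t∈right | inj₁ t∈A₁ with meet D (A₁⊆left t∈A₁) t∈right
        ...   | inj₁ t≡p = inj₁ t≡p
        ...   | inj₂ refl = ⊥-elim (x∉A₁ t∈A₁)

    step : DisjointPaths H p x → H x y → y ≢ p → Star (H -ᵛ x) y p → DisjointPaths H p y
    step {x = x} {y = y} D xy y≢p W with toPath _≟_ W
    ... | W₀ , pW₀ , _ = rerouteAt hits
      where
        onPaths? : Decidable₁ λ t → t ∈ vertices (left D) ⊎ t ∈ vertices (right D)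
        onPaths? t = (t ∈? vertices (left D)) ⊎-dec (t ∈? vertices (right D))

        open FirstHit (firstHit onPaths? W₀ (lose (end∈ W₀) (inj₁ (start∈ (left D)))))

        Rh = Star.map proj₁ before
        pRh = map-isPath proj₁ before (before-isPath pW₀)

        Rh∌x : ∀ {t} → t ∈ vertices Rh → t ≢ x
        Rh∌x = -ᵛ-avoids before (-ᵛ-source W y≢p) ∘ ∈-map⁻ proj₁ before

        rerouteAt : hit ∈ vertices (left D) ⊎ hit ∈ vertices (right D) → DisjointPaths H p y
        rerouteAt (inj₁ z∈left) =
          reroute D xy y≢p Rh pRh Rh∌x (first ∘ ∈-map⁻ proj₁ before) z∈left
        rerouteAt (inj₂ z∈right) =
          reroute (swap D) xy y≢p Rh pRh Rh∌x
                  (λ m → first (∈-map⁻ proj₁ before m) ∘ Sum.swap) z∈right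

    -- Walk along a path Q to q, keeping two internally disjoint paths from p to the current vertex x.
    -- To advance to the next vertex y, take a path from y back to p avoiding x and stop at its first
    -- vertex z on the two paths: the path through z is rerouted along it, the other gets the edge xy.
    extendAlong : (Q : Star H x q) → IsPath Q → p ∉ vertices Q → DisjointPaths H p x → DisjointPaths H p q
    extendAlong ε _ _ D = D
    extendAlong {x = x} (xy ◅ Q) (x∉Q ∷ pQ) p∉ D =
      extendAlong Q pQ (p∉ ∘ there)
        (step D xy y≢p (restrict Q Q∌x ◅◅ reverse (-ᵛ-sym H-sym) (unseparated x x≢p x≢q)))
      where
        Q∌x : ∀ {t} → t ∈ vertices Q → t ≢ x
        Q∌x t∈Q refl = All¬⇒¬Any x∉Q t∈Q
        y≢p : _ ≢ p
        y≢p y≡p = p∉ (there (subst (_∈ vertices Q) y≡p (start∈ Q)))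
        x≢p : x ≢ p
        x≢p x≡p = p∉ (here (sym x≡p))
        x≢q : x ≢ q
        x≢q x≡q = Q∌x (end∈ Q) (sym x≡q)

    fan : p ≢ q → Star H p q → DisjointPaths H p q
    fan p≢q W with toPath _≟_ W
    ... | ε , _ , _ = ⊥-elim (p≢q refl)
    ... | pp₁ ◅ Q , p∉Q ∷ pQ , _ = extendAlong Q pQ (All¬⇒¬Any p∉Q) record
      { left = pp₁ ◅ ε ; right = pp₁ ◅ ε ; left-isPath = pp₁-isPath ; right-isPath = pp₁-isPath
      ; meet = λ { (here t≡p) _ → inj₁ t≡p ; (there (here t≡p₁)) _ → inj₂ t≡p₁ } }
      where
        pp₁-isPath : IsPath {R = H} (pp₁ ◅ ε)
        pp₁-isPath = edge-isPath {R = H} pp₁ λ p≡p₁ → All¬⇒¬Any p∉Q (subst (_∈ vertices Q) (sym p≡p₁) (start∈ Q))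

-- Reachability in a finite graph

module _ {m : ℕ} {R : Rel (Fin m) 0ℓ} where

  path-len< : {x y : Fin m} (w : Star R x y) → IsPath w → len w < m
  path-len< w pw = injective⇒≤ λ {i} {j} eq →
    toℕ-injective (at-injective w pw (toℕ≤pred[n] i) (toℕ≤pred[n] j) eq)

  Within : ℕ → Rel (Fin m) 0ℓ
  Within zero a b = a ≡ b
  Within (suc k) a b = a ≡ b ⊎ ∃ λ c → R a c × Within k c b

  module _ (R? : Decidable R) where

    within? : ∀ k → Decidable (Within k)
    within? zero a b = a Fin.≟ b
    within? (suc k) a b = (a Fin.≟ b) ⊎-dec any? λ c → R? a c ×-dec within? k c b

    within⇒star : ∀ k {a b} → Within k a b → Star R a b
    within⇒star zero refl = ε
    within⇒star (suc k) (inj₁ refl) = ε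
    within⇒star (suc k) (inj₂ (_ , r , rest)) = r ◅ within⇒star k rest

    star⇒within : ∀ k {a b} (w : Star R a b) → len w ≤ k → Within k a b
    star⇒within zero ε _ = refl
    star⇒within (suc k) ε _ = inj₁ refl
    star⇒within (suc k) (r ◅ w) (s≤s len≤k) = inj₂ (_ , r , star⇒within k w len≤k)

    -- A walk shortens to a path, and a path on m vertices has fewer than m steps.
    reachable? : Decidable (Star R)
    reachable? a b with within? m a b
    ... | yes r = yes (within⇒star m r)
    ... | no ¬r = no λ w → let (w′ , pw′ , _) = toPath Fin._≟_ w in
                           ¬r (star⇒within m w′ (<⇒≤ (path-len< w′ pw′)))

module _ {A : Set} {a b c p q : A} where

  three-distinct-∉-pair : a ≢ b → a ≢ c → b ≢ c
                        → a ≡ p ⊎ a ≡ q → b ≡ p ⊎ b ≡ q → c ≡ p ⊎ c ≡ q → ⊥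
  three-distinct-∉-pair a≢b _ _ (inj₁ refl) (inj₁ refl) _ = a≢b refl
  three-distinct-∉-pair _ a≢c _ (inj₁ refl) (inj₂ refl) (inj₁ refl) = a≢c refl
  three-distinct-∉-pair _ _ b≢c (inj₁ refl) (inj₂ refl) (inj₂ refl) = b≢c refl
  three-distinct-∉-pair a≢b _ _ (inj₂ refl) (inj₂ refl) _ = a≢b refl
  three-distinct-∉-pair _ _ b≢c (inj₂ refl) (inj₁ refl) (inj₁ refl) = b≢c refl
  three-distinct-∉-pair _ a≢c _ (inj₂ refl) (inj₁ refl) (inj₂ refl) = a≢c refl

-- Chordless graphs

module _ (G : Graph) where
  open Graph G using (n; adj)

  private
    variable
      p q s t u v w x y z : V G

  E-sym : Symmetric (E G)
  E-sym {x} {y} xy = trans (Graph.sym G y x) xy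

  E⇒≢ : E G x y → x ≢ y
  E⇒≢ {x} xx refl with trans (sym xx) (Graph.irrefl G x)
  ... | ()

  E? : Decidable (E G)
  E? x y = adj x y Bool.≟ true

  E-ᵉ-ᵛ? : ∀ p q w → Decidable (E G -ᵉ (p , q) -ᵛ w)
  E-ᵉ-ᵛ? p q = -ᵛ-dec Fin._≟_ (-ᵉ-dec Fin._≟_ E? p q)

  record ThreeNeighbours (v : V G) : Set where
    field
      {a b c} : V G
      va : E G v a
      vb : E G v b
      vc : E G v c
      a≢b : a ≢ b
      a≢c : a ≢ c
      b≢c : b ≢ c

  3≤deg⇒threeNeighbours : 3 ≤ deg G v → ThreeNeighbours v
  3≤deg⇒threeNeighbours {v} = fromList (filter⁺ (T? ∘ adj v) (allFin⁺ n)) neighbour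
    where
      neighbour : ∀ {u} → u ∈ filterᵇ (adj v) (allFin n) → E G v u
      neighbour u∈ = Equivalence.to T-≡ (proj₂ (∈-filter⁻ (T? ∘ adj v) {xs = allFin n} u∈))

      fromList : ∀ {us} → Unique us → (∀ {u} → u ∈ us → E G v u) → 3 ≤ length us
               → ThreeNeighbours v
      fromList {[]} _ _ ()
      fromList {_ ∷ []} _ _ (s≤s ())
      fromList {_ ∷ _ ∷ []} _ _ (s≤s (s≤s ()))
      fromList {_ ∷ _ ∷ _ ∷ _} ((a≢b ∷ a≢c ∷ _) ∷ (b≢c ∷ _) ∷ _) nb _ = record
        { va = nb (here refl) ; vb = nb (there (here refl)) ; vc = nb (there (there (here refl)))
        ; a≢b = a≢b ; a≢c = a≢c ; b≢c = b≢c }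

  neighbour∉₂ : ThreeNeighbours v → ∀ p q → ∃ λ y → E G v y × y ≢ p × y ≢ q
  neighbour∉₂ {v} N p q = pick (oneOf? a) (oneOf? b) (oneOf? c)
    where
      open ThreeNeighbours N

      oneOf? : ∀ y → Dec (y ≡ p ⊎ y ≡ q)
      oneOf? y = (y Fin.≟ p) ⊎-dec (y Fin.≟ q)

      pick : Dec (a ≡ p ⊎ a ≡ q) → Dec (b ≡ p ⊎ b ≡ q) → Dec (c ≡ p ⊎ c ≡ q)
           → ∃ λ y → E G v y × y ≢ p × y ≢ q
      pick (no a∉) _ _ = a , va , a∉ ∘ inj₁ , a∉ ∘ inj₂
      pick (yes _) (no b∉) _ = b , vb , b∉ ∘ inj₁ , b∉ ∘ inj₂
      pick (yes _) (yes _) (no c∉) = c , vc , c∉ ∘ inj₁ , c∉ ∘ inj₂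
      pick (yes a∈) (yes b∈) (yes c∈) = ⊥-elim (three-distinct-∉-pair a≢b a≢c b≢c a∈ b∈ c∈)

  twoNeighbours∉ : ThreeNeighbours v → ∀ q
                 → ∃₂ λ y₁ y₂ → E G v y₁ × E G v y₂ × y₁ ≢ y₂ × y₁ ≢ q × y₂ ≢ q
  twoNeighbours∉ N q with neighbour∉₂ N q q
  ... | y₁ , vy₁ , y₁≢q , _ with neighbour∉₂ N q y₁
  ...   | y₂ , vy₂ , y₂≢q , y₂≢y₁ = y₁ , y₂ , vy₁ , vy₂ , y₂≢y₁ ∘ sym , y₁≢q , y₂≢q

  module _ {T : Pred (V G) 0ℓ} {s t : V G} where

    inducedPath-start-degree≤1 : InducedPathFromTo G T s t → T x → T y → E G s x → E G s y → x ≡ y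
    inducedPath-start-degree≤1 (_ , path , _ , covers , (i₀ , i₀≡0 , refl) , _ , adjacent) tx ty sx sy
      with Equivalence.to (covers _) tx | Equivalence.to (covers _) ty
    ... | i , refl | j , refl =
      cong path (toℕ-injective (trans (atPosition1 (Equivalence.to (adjacent i₀ i) sx))
                                      (sym (atPosition1 (Equivalence.to (adjacent i₀ j) sy)))))
      where
        atPosition1 : ∀ {k} → suc (toℕ i₀) ≡ k ⊎ suc k ≡ toℕ i₀ → k ≡ 1
        atPosition1 (inj₁ refl) = cong suc i₀≡0
        atPosition1 (inj₂ k+1≡i₀) with trans k+1≡i₀ i₀≡0
        ... | ()

    inducedPath-degree≤2 : InducedPathFromTo G T s t → T z → T x → T y → T w
                         → E G z x → E G z y → E G z w → x ≢ y → x ≢ w → y ≢ w → ⊥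
    inducedPath-degree≤2 (_ , path , _ , covers , _ , _ , adjacent) tz tx ty tw zx zy zw x≢y x≢w y≢w
      with Equivalence.to (covers _) tz | Equivalence.to (covers _) tx
         | Equivalence.to (covers _) ty | Equivalence.to (covers _) tw
    ... | k , refl | i , refl | j , refl | l , refl =
      three-distinct-∉-pair (x≢y ∘ cong path ∘ toℕ-injective) (x≢w ∘ cong path ∘ toℕ-injective)
        (y≢w ∘ cong path ∘ toℕ-injective) (besideK zx) (besideK zy) (besideK zw)
      where
        besideK : ∀ {i} → E G (path k) (path i) → toℕ i ≡ suc (toℕ k) ⊎ toℕ i ≡ pred (toℕ k)
        besideK {i} ki with Equivalence.to (adjacent k i) ki
        ... | inj₁ k+1≡i = inj₁ (sym k+1≡i)
        ... | inj₂ i+1≡k = inj₂ (cong pred i+1≡k)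

  closedWalk⇒isCycle : {R : Rel (V G) 0ℓ} → R ⇒ E G → (C : Star R s s) → 3 ≤ len C
                     → (∀ {i j} → i < len C → j < len C → at C i ≡ at C j → i ≡ j)
                     → IsCycle G (len C) (at C ∘ toℕ)
  closedWalk⇒isCycle R⇒E C 3≤len inj =
    3≤len , (λ {i} {j} eq → toℕ-injective (inj (toℕ<n i) (toℕ<n j) eq)) , adjacent
    where
      forward : ∀ {i j} → suc i ≡ j → j ≤ len C → E G (at C i) (at C j)
      forward refl j≤len = R⇒E (at-step C j≤len)

      closing : ∀ {i j} → toℕ i ≡ 0 → suc (toℕ j) ≡ len C → E G (at C (toℕ j)) (at C (toℕ i))
      closing i≡0 j+1≡len =
        subst (E G _) (trans (at-len C) (sym (cong (at C) i≡0))) (forward j+1≡len ≤-refl)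

      adjacent : ∀ i j → CycConsec G (len C) i j → E G (at C (toℕ i)) (at C (toℕ j))
      adjacent i j (inj₁ i+1≡j) = forward i+1≡j (<⇒≤ (toℕ<n j))
      adjacent i j (inj₂ (inj₁ j+1≡i)) = E-sym (forward j+1≡i (<⇒≤ (toℕ<n i)))
      adjacent i j (inj₂ (inj₂ (inj₁ (i≡0 , j+1≡len)))) = E-sym (closing i≡0 j+1≡len)
      adjacent i j (inj₂ (inj₂ (inj₂ (j≡0 , i+1≡len)))) = closing j≡0 i+1≡len

  nonConsecutive : ∀ {k} {i j : Fin k}
                 → toℕ i ≡ 0 → 2 ≤ toℕ j → 2 + toℕ j ≤ k → ¬ CycConsec G k i j
  nonConsecutive i≡0 2≤j _ (inj₁ i+1≡j) with subst (2 ≤_) (trans (sym i+1≡j) (cong suc i≡0)) 2≤j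
  ... | s≤s ()
  nonConsecutive i≡0 _ _ (inj₂ (inj₁ j+1≡i)) with trans j+1≡i i≡0
  ... | ()
  nonConsecutive {j = j} _ _ j+2≤k (inj₂ (inj₂ (inj₁ (_ , j+1≡k)))) =
    <-irrefl refl (subst (2 + toℕ j ≤_) (sym j+1≡k) j+2≤k)
  nonConsecutive _ 2≤j _ (inj₂ (inj₂ (inj₂ (j≡0 , _)))) with subst (2 ≤_) j≡0 2≤j
  ... | ()

  closedWalk-chord : {R : Rel (V G) 0ℓ} (C : Star R s s) {j : ℕ} → 2 ≤ j → 2 + j ≤ len C
                   → E G s (at C j) → HasChord G (len C) (at C ∘ toℕ)
  closedWalk-chord C {j} 2≤j j+2≤len sj =
    i₀ , j₀
    , subst₂ (E G) (cong (at C) (sym (toℕ-fromℕ< 0<len))) (cong (at C) (sym (toℕ-fromℕ< j<len))) sj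
    , nonConsecutive (toℕ-fromℕ< 0<len) (subst (2 ≤_) (sym (toℕ-fromℕ< j<len)) 2≤j)
                     (subst (λ j → 2 + j ≤ len C) (sym (toℕ-fromℕ< j<len)) j+2≤len)
    where
      j<len : j < len C
      j<len = ≤-trans (n≤1+n _) j+2≤len
      0<len : 0 < len C
      0<len = ≤-trans (s≤s z≤n) j<len
      i₀ = fromℕ< 0<len
      j₀ = fromℕ< j<len

  chordless⇒¬disjointPaths : Chordless G → E G s t → ¬ DisjointPaths (E G -ᵉ (s , t)) s t
  chordless⇒¬disjointPaths _ st record { left = ε } = E⇒≢ st refl
  chordless⇒¬disjointPaths {s} {t} chordless st
    record { left = e ◅ A′ ; right = B ; left-isPath = s∉A′ ∷ pA′ ; right-isPath = pB ; meet = meet } =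
    chordless (len C) (at C ∘ toℕ)
      (closedWalk⇒isCycle proj₁ C (belowLen (≤-trans 2≤b (m≤n+m _ _))) (edge◅path-at-injective e P pP))
      (closedWalk-chord C (s≤s 1≤a) (belowLen a+2≤a+b)
                        (subst (E G s) (sym (trans (at-◅◅ˡ A′ B′ ≤-refl) (at-len A′))) st))
    where
      H-sym = -ᵉ-sym {p = s} {q = t} E-sym
      B′ = reverse H-sym B
      P = A′ ◅◅ B′
      C = e ◅ P

      meetP : ∀ {u} → u ∈ vertices A′ → u ∈ vertices B′ → u ≡ t
      meetP u∈A′ u∈B′ with meet (there u∈A′) (∈-reverse⁻ H-sym B u∈B′)
      ... | inj₁ refl = ⊥-elim (All¬⇒¬Any s∉A′ u∈A′)
      ... | inj₂ u≡t = u≡t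

      pP : IsPath P
      pP = ◅◅-isPath A′ B′ pA′ (reverse-isPath H-sym B pB) meetP

      1≤a : 1 ≤ len A′
      1≤a with 2≤len (e ◅ A′) (E⇒≢ st) (λ (_ , ¬st , _) → ¬st (refl , refl))
      ... | s≤s 1≤a = 1≤a

      2≤b : 2 ≤ len B′
      2≤b = 2≤len B′ (E⇒≢ st ∘ sym) (λ (_ , _ , ¬ts) → ¬ts (refl , refl))

      a+2≤a+b : 2 + len A′ ≤ len A′ + len B′
      a+2≤a+b = subst (_≤ len A′ + len B′) (+-comm (len A′) 2) (+-monoʳ-≤ (len A′) 2≤b)

      belowLen : ∀ {k} → k ≤ len A′ + len B′ → suc k ≤ len C
      belowLen {k} = subst (suc k ≤_) (cong suc (sym (len-◅◅ A′ B′))) ∘ s≤s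

  chordless⇒¬unseparated : Chordless G → E G p q
                         → (∀ w → w ≢ p → w ≢ q → Star (E G -ᵉ (p , q) -ᵛ w) p q)
                         → ¬ Star (E G -ᵉ (p , q)) p q
  chordless⇒¬unseparated chordless pq unseparated =
    chordless⇒¬disjointPaths chordless pq ∘ Fan.fan Fin._≟_ (-ᵉ-sym E-sym) unseparated (E⇒≢ pq)

  reachSeparation : {R : Rel (V G) 0ℓ} (R? : Decidable R) (S : Pred (V G) 0ℓ) (r : V G)
                  → (∀ {x y} → ¬ S x → ¬ S y → E G x y → R x y)
                  → ¬ S x → Star R r x → ¬ S y → ¬ Star R r y
                  → Separation G S (λ v → does (reachable? R? r v))
  reachSeparation R? S r inside x∉S rx y∉S ¬ry =
    (_ , x∉S , dec-true (reachable? R? r _) rx) , (_ , y∉S , dec-false (reachable? R? r _) ¬ry) , noEdge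
    where
      side = λ v → does (reachable? R? r v)

      noEdge : ∀ x y → InX G S side x → InY G S side y → ¬ E G x y
      noEdge x y (x∉S , x∈X) (y∉S , y∈Y) xy with reachable? R? r x | reachable? R? r y
      noEdge x y (x∉S , ()) (y∉S , y∈Y) xy | no _ | _
      noEdge x y (x∉S , x∈X) (y∉S , ()) xy | yes _ | yes _
      ... | yes rx | no ¬ry = ¬ry (rx ◅◅ (inside x∉S y∉S xy ◅ ε))

  cutVertex : x ≢ u → y ≢ u → ¬ Star (E G -ᵛ u) x y → Has1Cutset G
  cutVertex {x} {u} x≢u y≢u ¬xy =
    u , _ , reachSeparation (-ᵛ-dec Fin._≟_ E? u) (_≡ u) x (λ x≢u y≢u xy → xy , x≢u , y≢u)
                            x≢u ε y≢u ¬xy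

  proper2Cutset : E G p q → ThreeNeighbours p → ThreeNeighbours q → w ≢ p → w ≢ q → ¬ E G p w
                → ¬ Star (E G -ᵉ (p , q) -ᵛ w) p q → HasProper2Cutset G
  proper2Cutset {p} {q} {w} pq Np Nq w≢p w≢q ¬pw ¬reach with twoNeighbours∉ Np q
  ... | _ , _ , py₁ , py₂ , y₁≢y₂ , y₁≢q , y₂≢q =
    p , w , side , w≢p ∘ sym , ¬pw
    , reachSeparation R? S p inside (proj₁ (inX py₁ y₁≢q)) (proj₂ (pathTo y₁≢q py₁)) q∉S ¬reach
    , (λ P → y₁≢y₂ (inducedPath-start-degree≤1 P (inj₁ (inX py₁ y₁≢q)) (inj₁ (inX py₂ y₂≢q))
                                                 py₁ py₂))
    , (λ P → inducedPath-degree≤2 P (inj₁ (q∉S , dec-false (reachable? R? p q) ¬reach))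
               (nearQ va) (nearQ vb) (nearQ vc) va vb vc a≢b a≢c b≢c)
    where
      open ThreeNeighbours Nq
      R = E G -ᵉ (p , q) -ᵛ w
      R? = E-ᵉ-ᵛ? p q w
      S = λ v → v ≡ p ⊎ v ≡ w
      side = λ v → does (reachable? R? p v)

      inside : ¬ S x → ¬ S y → E G x y → R x y
      inside x∉S y∉S xy = (xy , x∉S ∘ inj₁ ∘ proj₁ , y∉S ∘ inj₁ ∘ proj₂) , x∉S ∘ inj₂ , y∉S ∘ inj₂

      q∉S : ¬ S q
      q∉S (inj₁ q≡p) = E⇒≢ pq (sym q≡p)
      q∉S (inj₂ q≡w) = w≢q (sym q≡w)

      pathTo : y ≢ q → E G p y → ¬ S y × Star R p y
      pathTo y≢q py = y∉S , ((py , y≢q ∘ proj₂ , E⇒≢ pq ∘ proj₁) , w≢p ∘ sym , y∉S ∘ inj₂) ◅ ε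
        where
          y∉S : ¬ S _
          y∉S (inj₁ y≡p) = E⇒≢ py (sym y≡p)
          y∉S (inj₂ y≡w) = ¬pw (subst (E G p) y≡w py)

      inX : E G p y → y ≢ q → InX G S side y
      inX py y≢q = proj₁ (pathTo y≢q py) , dec-true (reachable? R? p _) (proj₂ (pathTo y≢q py))

      nearQ : E G q x → InY G S side x ⊎ S x
      nearQ {x} qx with (x Fin.≟ p) ⊎-dec (x Fin.≟ w)
      ... | yes x∈S = inj₂ x∈S
      ... | no x∉S =
        inj₁ (x∉S , dec-false (reachable? R? p x) λ px → ¬reach (px ◅◅ (inside x∉S q∉S (E-sym qx) ◅ ε)))

  triangle⇒cutVertex : Chordless G → E G p q → E G p w → E G q w → E G p v → v ≢ q → v ≢ w
                     → ¬ Star (E G -ᵉ (p , q) -ᵛ w) p q → Has1Cutset G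
  triangle⇒cutVertex {p} {q} {w} {v} chordless pq pw qw pv v≢q v≢w ¬reach
    with reachable? (-ᵛ-dec Fin._≟_ E? p) v w
  ... | no ¬vw = cutVertex (E⇒≢ pv ∘ sym) (E⇒≢ pw ∘ sym) ¬vw
  ... | yes vw = ⊥-elim (viaHit hits)
    where
      open FirstHit (firstHit (λ t → (t Fin.≟ q) ⊎-dec (t Fin.≟ w)) vw (lose (end∈ vw) (inj₂ refl)))

      v≢hit : v ≢ hit
      v≢hit v≡hit = Sum.[ v≢q ∘ trans v≡hit , v≢w ∘ trans v≡hit ] hits

      detour : ∀ u → u ≡ q ⊎ u ≡ w → u ≢ hit → p ≢ u → Star (E G -ᵉ (p , hit) -ᵛ u) p hit
      detour u u∈qw u≢hit p≢u =
        ((pv , v≢hit ∘ proj₂ , E⇒≢ pv ∘ sym ∘ proj₂) , p≢u , avoids (start∈ beforeᵉ))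
        ◅ restrict beforeᵉ avoids
        where
          toᵉ : (E G -ᵛ p) ⇒ (E G -ᵉ (p , hit))
          toᵉ = -ᵛ⇒-ᵉ {R = E G}
          beforeᵉ = Star.map toᵉ before
          avoids : ∀ {t} → t ∈ vertices beforeᵉ → t ≢ u
          avoids t∈ refl = u≢hit (first (∈-map⁻ toᵉ before t∈) u∈qw)

      viaHit : hit ≡ q ⊎ hit ≡ w → ⊥
      viaHit (inj₁ hit≡q) =
        ¬reach (subst (λ z → Star (E G -ᵉ (p , z) -ᵛ w) p z) hit≡q
                      (detour w (inj₂ refl) (λ w≡hit → E⇒≢ qw (sym (trans w≡hit hit≡q))) (E⇒≢ pw)))
      viaHit (inj₂ hit≡w) = chordless⇒¬unseparated chordless pw unseparated (Star.map proj₁ avoidingQ)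
        where
          avoidingQ : Star (E G -ᵉ (p , w) -ᵛ q) p w
          avoidingQ = subst (λ z → Star (E G -ᵉ (p , z) -ᵛ q) p z) hit≡w
                        (detour q (inj₁ refl) (λ q≡hit → E⇒≢ qw (trans q≡hit hit≡w)) (E⇒≢ pq))

          viaQ : ∀ {u} → p ≢ u → q ≢ u → w ≢ u → Star (E G -ᵉ (p , w) -ᵛ u) p w
          viaQ p≢u q≢u w≢u =
            ((pq , E⇒≢ qw ∘ proj₂ , E⇒≢ pw ∘ proj₁) , p≢u , q≢u)
            ◅ ((qw , E⇒≢ pq ∘ sym ∘ proj₁ , E⇒≢ qw ∘ proj₁) , q≢u , w≢u) ◅ ε

          unseparated : ∀ u → u ≢ p → u ≢ w → Star (E G -ᵉ (p , w) -ᵛ u) p w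
          unseparated u u≢p u≢w with u Fin.≟ q
          ... | yes refl = avoidingQ
          ... | no u≢q = viaQ (u≢p ∘ sym) (u≢q ∘ sym) (u≢w ∘ sym)

  sparse⊎richEdge : Sparse G ⊎ ∃₂ λ u v → E G u v × 3 ≤ deg G u × 3 ≤ deg G v
  sparse⊎richEdge with any? (λ u → any? λ v → E? u v ×-dec (3 ≤? deg G u) ×-dec (3 ≤? deg G v))
  ... | yes (u , v , rich) = inj₂ (u , v , rich)
  ... | no ¬rich = inj₁ λ u v uv degs → ¬rich (u , v , uv , degs)

  separated⊎unseparated : ∀ p q → (∃ λ w → w ≢ p × w ≢ q × ¬ Star (E G -ᵉ (p , q) -ᵛ w) p q)
                                ⊎ (∀ w → w ≢ p → w ≢ q → Star (E G -ᵉ (p , q) -ᵛ w) p q)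
  separated⊎unseparated p q
    with any? (λ w → ¬? (w Fin.≟ p) ×-dec ¬? (w Fin.≟ q) ×-dec ¬? (reachable? (E-ᵉ-ᵛ? p q w) p q))
  ... | yes separator = inj₁ separator
  ... | no ¬separator = inj₂ λ w w≢p w≢q →
    decidable-stable (reachable? (E-ᵉ-ᵛ? p q w) p q) λ ¬reach → ¬separator (w , w≢p , w≢q , ¬reach)

  reverse-swap : Star (E G -ᵉ (q , p) -ᵛ w) q p → Star (E G -ᵉ (p , q) -ᵛ w) p q
  reverse-swap = reverse (-ᵛ-sym (-ᵉ-sym E-sym)) ∘ Star.map (Product.map₁ (-ᵉ-swap {R = E G}))

  richEdge⇒cutset : Chordless G → E G u v → ThreeNeighbours u → ThreeNeighbours v
                  → Has1Cutset G ⊎ HasProper2Cutset G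
  richEdge⇒cutset {u} {v} chordless uv Nu Nv with separated⊎unseparated u v
  ... | inj₂ unseparated with neighbour∉₂ Nu v v
  ...   | w , uw , w≢v , _ =
    ⊥-elim (chordless⇒¬unseparated chordless uv unseparated
              (Star.map proj₁ (unseparated w (E⇒≢ uw ∘ sym) w≢v)))
  richEdge⇒cutset {u} {v} chordless uv Nu Nv | inj₁ (w , w≢u , w≢v , ¬reach) with E? u w | E? v w
  ... | no ¬uw | _ = inj₂ (proper2Cutset uv Nu Nv w≢u w≢v ¬uw ¬reach)
  ... | yes _ | no ¬vw = inj₂ (proper2Cutset (E-sym uv) Nv Nu w≢v w≢u ¬vw (¬reach ∘ reverse-swap))
  ... | yes uw | yes vw with neighbour∉₂ Nu v w
  ...   | x , ux , x≢v , x≢w = inj₁ (triangle⇒cutVertex chordless uv uw vw ux x≢v x≢w ¬reach)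

mainTheorem9 : (G : Graph) → Chordless G → Sparse G ⊎ Has1Cutset G ⊎ HasProper2Cutset G
mainTheorem9 G chordless with sparse⊎richEdge G
... | inj₁ sparse = inj₁ sparse
... | inj₂ (_ , _ , uv , 3≤deg-u , 3≤deg-v) =
  inj₂ (richEdge⇒cutset G chordless uv (3≤deg⇒threeNeighbours G 3≤deg-u)
                                       (3≤deg⇒threeNeighbours G 3≤deg-v))
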